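{- Let $R$ be a subdirect product of SBM algebras $\mathbb{A}_1,\dots,\mathbb{A}_n$, let $i,j\in[n]$, let $\alpha\prec\beta\subseteq\theta_{\mathbb{A}_i}$ be congruences of $\mathbb{A}_i$ and $\gamma\prec\delta\subseteq\theta_{\mathbb{A}_j}$ congruences of $\mathbb{A}_j$. If $(\alpha,\beta)$ can be separated from $(\gamma,\delta)$ in $R$, then for any $(\alpha,\beta)$-minimal set $U$ of $\mathbb{A}_i$ there is an idempotent unary polynomial $\mathbf{g}$ of $R$ such that $g_i(A_i)=U$ and $\mathbf{g}$ separates $(\alpha,\beta)$ from $(\gamma,\delta)$.
   Context: SBM algebras (paper's convention): an SBM algebra is a finite idempotent algebra $\mathbb{A}=(A;\cdot,m)$ with binary $\cdot$ and ternary $m$ as basic operations and a congruence $\sigma_{\mathbb{A}}$ such that $\mathbb{A}/\sigma_{\mathbb{A}}$ is term equivalent to a semilattice with operation induced by $\cdot$, $xy=x$ and $m$ Mal'tsev on each $\sigma_{\mathbb{A}}$-block, $x(xy)=xy$, and $m(a,b,c)\,\sigma_{\mathbb{A}}\,(ab)c$. $\max(\mathbb{A})$ is the $\sigma_{\mathbb{A}}$-block that is the greatest element of $\mathbb{A}/\sigma_{\mathbb{A}}$; $\theta_{\mathbb{A}}$ is the equivalence with blocks $\max(\mathbb{A})$ and singletons outside it. $R$ subdirect product: subalgebra of $\prod\mathbb{A}_\ell$ with surjective projections. $\alpha\prec\beta$: $\alpha<\beta$, nothing strictly between. Unary polynomial of $\mathbb{A}$: $x\mapsto t(x,a_1,\dots,a_l)$,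 $t$ a term operation. Unary polynomial of $R$: $\mathbf{f}(x)=t(x,\mathbf{a}^1,\dots,\mathbf{a}^l)$, $\mathbf{a}^k\in R$, with coordinate actions $f_\ell(x)=t(x,\mathbf{a}^1[\ell],\dots,\mathbf{a}^l[\ell])$; it is idempotent if $\mathbf{f}\circ\mathbf{f}=\mathbf{f}$. $f(\beta)\subseteq\alpha$ means $(a,b)\in\beta\Rightarrow(f(a),f(b))\in\alpha$. $\mathbf{f}$ separates $(\alpha,\beta)$ from $(\gamma,\delta)$ if $f_i(\beta)\not\subseteq\alpha$ and $f_j(\delta)\subseteq\gamma$. An $(\alpha,\beta)$-minimal set of $\mathbb{A}_i$ is a set $U$, minimal under inclusion, with $U=h(A_i)$ for some unary polynomial $h$ of $\mathbb{A}_i$ with $h(\beta)\not\subseteq\alpha$. -}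

module Defs where

open import Data.Nat using (ℕ; suc)
open import Data.Fin using (Fin)
open import Data.Product using (Σ; ∃; _×_; _,_)
open import Data.Sum using (_⊎_)
open import Data.Vec.Functional using (_∷_)
open import Relation.Binary.PropositionalEquality using (_≡_)
open import Relation.Nullary using (¬_)

Rel : Set → Set₁
Rel A = A → A → Set

Pred : Set → Set₁
Pred A = A → Set

_⊆ᵣ_ : {A : Set} → Rel A → Rel A → Set
α ⊆ᵣ β = ∀ a b → α a b → β a b

_⊆ₚ_ : {A : Set} → Pred A → Pred A → Set
U ⊆ₚ V = ∀ a → U a → V a

_≐_ : {A : Set} → Pred A → Pred A → Set
U ≐ V = (U ⊆ₚ V) × (V ⊆ₚ U)

Image : {A B : Set} → (A → B) → Pred B
Image f y = ∃ λ x → f x ≡ y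

MapsInto : {A : Set} → (A → A) → Rel A → Rel A → Set
MapsInto f β α = ∀ a b → β a b → α (f a) (f b)

data Term (n : ℕ) : Set where
  var : Fin n → Term n
  _·ₜ_ : Term n → Term n → Term n
  mₜ : Term n → Term n → Term n → Term n

data STerm (n : ℕ) : Set where
  svar : Fin n → STerm n
  _·ₛ_ : STerm n → STerm n → STerm n

record Alg : Set where
  field
    size : ℕ
    _·_ : Fin size → Fin size → Fin size
    m : Fin size → Fin size → Fin size → Fin size

  Carrier : Set
  Carrier = Fin size

  eval : {n : ℕ} → Term n → (Fin n → Carrier) → Carrier
  eval (var x) ρ = ρ x
  eval (s ·ₜ t) ρ = eval s ρ · eval t ρ
  eval (mₜ s t u) ρ = m (eval s ρ) (eval t ρ) (eval u ρ)

  evalS : {n : ℕ} → STerm n → (Fin n → Carrier) → Carrier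
  evalS (svar x) ρ = ρ x
  evalS (s ·ₛ t) ρ = evalS s ρ · evalS t ρ

  record IsCongruence (θ : Rel Carrier) : Set where
    field
      refl : ∀ a → θ a a
      sym : ∀ a b → θ a b → θ b a
      trans : ∀ a b c → θ a b → θ b c → θ a c
      compat· : ∀ a a' b b' → θ a a' → θ b b' → θ (a · b) (a' · b')
      compatm : ∀ a a' b b' c c' → θ a a' → θ b b' → θ c c' →
                θ (m a b c) (m a' b' c')

  Covers : Rel Carrier → Rel Carrier → Set₁
  Covers α β = (α ⊆ᵣ β) × (¬ (β ⊆ᵣ α)) ×
    (∀ (γ : Rel Carrier) → IsCongruence γ → α ⊆ᵣ γ → γ ⊆ᵣ β →
       (γ ⊆ᵣ α) ⊎ (β ⊆ᵣ γ))

  record UPoly : Set where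
    field
      arity : ℕ
      term : Term (suc arity)
      consts : Fin arity → Carrier
    apply : Carrier → Carrier
    apply x = eval term (x ∷ consts)

  IsMinimalSet : Rel Carrier → Rel Carrier → Pred Carrier → Set
  IsMinimalSet α β U =
    (Σ UPoly λ h → (¬ MapsInto (UPoly.apply h) β α) × (U ≐ Image (UPoly.apply h))) ×
    (∀ (h : UPoly) → ¬ MapsInto (UPoly.apply h) β α →
       Image (UPoly.apply h) ⊆ₚ U → U ⊆ₚ Image (UPoly.apply h))

-- SBM algebra (σ is part of the data)
record SBM : Set₁ where
  field
    alg : Alg
  open Alg alg
  field
    σ : Rel Carrier
    idem· : ∀ x → x · x ≡ x
    idemm : ∀ x → m x x x ≡ x
    σ-cong : IsCongruence σ
    -- A/σ is a semilattice w.r.t. the operation induced by ·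
    quot-assoc : ∀ x y z → σ ((x · y) · z) (x · (y · z))
    quot-comm : ∀ x y → σ (x · y) (y · x)
    -- ... and A/σ is term equivalent to it: every term operation of A/σ
    -- is a semilattice term operation (the converse is automatic)
    quot-termEquiv : ∀ {n : ℕ} (t : Term n) →
      Σ (STerm n) λ s → ∀ (ρ : Fin n → Carrier) → σ (eval t ρ) (evalS s ρ)
    block-left : ∀ x y → σ x y → x · y ≡ x
    block-malcev₁ : ∀ x y → σ x y → m x y y ≡ x
    block-malcev₂ : ∀ x y → σ x y → m y y x ≡ x
    absorb : ∀ x y → x · (x · y) ≡ x · y
    m-σ : ∀ a b c → σ (m a b c) ((a · b) · c)

  -- max(A): the σ-block that is the greatest element of A/σ,
  -- order a ≤ b iff ab = b (join), so the top block absorbs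
  InMax : Pred Carrier
  InMax a = ∀ b → σ (a · b) a

  θ : Rel Carrier
  θ a b = (a ≡ b) ⊎ (InMax a × InMax b)

Car : SBM → Set
Car A = Alg.Carrier (SBM.alg A)

module Product {n : ℕ} (As : Fin n → SBM) where

  Tuple : Set
  Tuple = (ℓ : Fin n) → Car (As ℓ)

  _·ᵖ_ : Tuple → Tuple → Tuple
  (a ·ᵖ b) ℓ = Alg._·_ (SBM.alg (As ℓ)) (a ℓ) (b ℓ)

  mᵖ : Tuple → Tuple → Tuple → Tuple
  mᵖ a b c ℓ = Alg.m (SBM.alg (As ℓ)) (a ℓ) (b ℓ) (c ℓ)

  record IsSubdirect (R : Pred Tuple) : Set where
    field
      closed· : ∀ a b → R a → R b → R (a ·ᵖ b)
      closedm : ∀ a b c → R a → R b → R c → R (mᵖ a b c)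
      surj : ∀ (ℓ : Fin n) (x : Car (As ℓ)) → Σ Tuple λ r → R r × (r ℓ ≡ x)

  record UPolyR (R : Pred Tuple) : Set where
    field
      arity : ℕ
      term : Term (suc arity)
      consts : Fin arity → Tuple
      constsInR : ∀ k → R (consts k)
    coord : (ℓ : Fin n) → Car (As ℓ) → Car (As ℓ)
    coord ℓ x = Alg.eval (SBM.alg (As ℓ)) term (x ∷ λ k → consts k ℓ)

  IdempotentR : {R : Pred Tuple} → UPolyR R → Set
  IdempotentR {R} f = ∀ r → R r → ∀ ℓ →
    UPolyR.coord f ℓ (UPolyR.coord f ℓ (r ℓ)) ≡ UPolyR.coord f ℓ (r ℓ)

  Separates : {R : Pred Tuple} → UPolyR R → (i j : Fin n) →
    Rel (Car (As i)) → Rel (Car (As i)) →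
    Rel (Car (As j)) → Rel (Car (As j)) → Set
  Separates f i j α β γ δ =
    (¬ MapsInto (UPolyR.coord f i) β α) × MapsInto (UPolyR.coord f j) δ γ

-- Since α ≺ β, for a polynomial F of 𝔸ᵢ preserving α the pairs (x , y) ∈ β with F (Q x) α F (Q y)
-- for every polynomial Q form a congruence between α and β, hence equal to α or to β. So whether
-- F collapses β into α is decidable, and if neither X nor Y collapses β into α, then for some
-- polynomial Q neither does X ∘ Q ∘ Y; such a Q is found by searching the finite clone of unary
-- polynomial functions.
-- Applied to a polynomial h with image U and the separating f this gives e = h ∘ Q ∘ f, and then,
-- applied to eᵢ twice, p = e ∘ Q′ with pᵢ ∘ eᵢ not collapsing β; minimality of U makes pᵢ map U
-- onto U without collapsing β on U. A power g = pᴺ whose exponent N is a multiple of the period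
-- of every coordinate map pℓ is idempotent, so gᵢ fixes U = gᵢ(Aᵢ) pointwise and still does not
-- collapse β, while gⱼ(δ) ⊆ γ persists because pⱼ preserves δ.

module Submission where

open import Defs
open import Data.Bool using (true)
open import Data.Fin using (Fin; zero; suc; toℕ; _↑ˡ_; _↑ʳ_; splitAt; funToFin; finToFun; _≟_)
open import Data.Fin.Properties using (any?; all?; pigeonhole; toℕ<n; finToFun-funToFin)
open import Data.Fin.Subset using (Subset; _∈_; _⊆_; ∣_∣) renaming (⊥ to ∅)
open import Data.Fin.Subset.Properties using (_∈?_; _⊂?_; ∣p∣≤n; p⊂q⇒∣p∣<∣q∣; ∉⊥)
open import Data.Nat using (ℕ; zero; suc; _+_; _*_; _∸_; _^_; _≤_; _<_; _⊔_; _!; z≤n; s≤s; >-nonZero)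
open import Data.Nat.Divisibility using (_∣_; m∣m*n; ∣-trans; m≤n⇒m!∣n!)
open import Data.Nat.GeneralisedArithmetic using (fold; fold-+)
open import Data.Nat.Properties
  using (≤-trans; ≤-pred; <⇒≤; n≮n; n<1+n; m∸n≤m; m∸n+n≡m; m<n⇒0<n∸m; +-comm; 1≤n!; m≤m*n
        ; m≤m⊔n; m≤n⊔m)
open import Data.Product using (Σ; ∃; ∃₂; _×_; _,_; proj₁; proj₂)
open import Data.Sum using (_⊎_; inj₁; inj₂; [_,_])
open import Data.Sum.Properties using ([,]-∘)
open import Data.Vec using (tabulate)
open import Data.Vec.Properties using (lookup∘tabulate; []=⇒lookup; lookup⇒[]=)
open import Data.Vec.Functional using (_∷_; _++_)
open import Data.Vec.Functional.Properties using (lookup-++ˡ; lookup-++ʳ)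
open import Data.Vec.Functional.Relation.Unary.All.Properties using (++⁺)
open import Function using (_∘_; id; const)
open import Relation.Binary.PropositionalEquality hiding ([_])
open import Relation.Nullary using (¬_; Dec; yes; no; does; contradiction)
open import Relation.Nullary.Decidable using (_×-dec_; _⊎-dec_; ¬?; dec-true; decidable-stable; map′)

module _ {A : Set} where

  MapsInto-resp : ∀ {F G : A → A} {β α : Rel A} → F ≗ G → MapsInto F β α → MapsInto G β α
  MapsInto-resp {α = α} F≗G F-into a b βab = subst₂ α (F≗G a) (F≗G b) (F-into a b βab)

  MapsInto-∘ : ∀ {F G : A → A} {α β γ : Rel A} → MapsInto F β γ → MapsInto G α β → MapsInto (F ∘ G) α γ
  MapsInto-∘ F-into G-into a b αab = F-into _ _ (G-into a b αab)

  fold-preserves : ∀ {g : A → A} {θ : Rel A} → MapsInto g θ θ → ∀ k → MapsInto (λ x → fold x g k) θ θ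
  fold-preserves g-pres zero a b θab = θab
  fold-preserves g-pres (suc k) a b θab = g-pres _ _ (fold-preserves g-pres k a b θab)

  fold-mapsInto : ∀ {g : A → A} {δ γ : Rel A} → MapsInto g δ δ → MapsInto g δ γ →
                  ∀ {k} → 1 ≤ k → MapsInto (λ x → fold x g k) δ γ
  fold-mapsInto g-pres g-into {suc k} _ a b δab = g-into _ _ (fold-preserves g-pres k a b δab)

  fold-image : ∀ {g : A → A} {U : Pred A} → Image g ⊆ₚ U → ∀ {k} → 1 ≤ k → Image (λ x → fold x g k) ⊆ₚ U
  fold-image {g} g⊆U {suc k} _ y (x , e) = g⊆U y (fold x g k , e)

  SurjectiveOn : Pred A → (A → A) → Set
  SurjectiveOn U g = ∀ u → U u → ∃ λ w → U w × g w ≡ u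

  fold-surjectiveOn : ∀ {g : A → A} {U : Pred A} → SurjectiveOn U g → ∀ k → SurjectiveOn U (λ x → fold x g k)
  fold-surjectiveOn g-onto zero u Uu = u , Uu , refl
  fold-surjectiveOn {g} g-onto (suc k) u Uu =
    let w₁ , Uw₁ , gw₁≡u = g-onto u Uu
        w , Uw , gᵏw≡w₁ = fold-surjectiveOn g-onto k w₁ Uw₁
    in w , Uw , trans (cong g gᵏw≡w₁) gw₁≡u

  fold-multiple : ∀ (g : A → A) {y d} → fold y g d ≡ y → ∀ c → fold y g (c * d) ≡ y
  fold-multiple g periodic zero = refl
  fold-multiple g {y} {d} periodic (suc c) = begin
    fold y g (d + c * d)          ≡⟨ fold-+ y g d ⟩
    fold (fold y g (c * d)) g d   ≡⟨ cong (λ z → fold z g d) (fold-multiple g periodic c) ⟩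
    fold y g d                    ≡⟨ periodic ⟩
    y                             ∎
    where open ≡-Reasoning

n∣n! : ∀ {n} → 0 < n → n ∣ n !
n∣n! {suc n} _ = m∣m*n (n !)

n≤n! : ∀ n → n ≤ n !
n≤n! zero = z≤n
n≤n! (suc n) = m≤m*n (suc n) (n !) {{>-nonZero (1≤n! n)}}

-- Every orbit of g is eventually periodic with preperiod and period at most s, and S ! is a
-- multiple of the period that exceeds the preperiod.
fold-idempotent : ∀ {s} (g : Fin s → Fin s) {S} → s ≤ S → ∀ x →
                  fold (fold x g (S !)) g (S !) ≡ fold x g (S !)
fold-idempotent {s} g {S} s≤S x with pigeonhole (n<1+n s) (λ k → fold x g (toℕ k))
... | i , j , i<j , gⁱx≡gʲx = begin
    fold (fold x g N) g N    ≡⟨ cong (λ z → fold z g N) x-split ⟩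
    fold (fold y g t) g N    ≡⟨ fold-+ y g N ⟨
    fold y g (N + t)         ≡⟨ cong (fold y g) (+-comm N t) ⟩
    fold y g (t + N)         ≡⟨ fold-+ y g t ⟩
    fold (fold y g N) g t    ≡⟨ cong (λ z → fold z g t) y-fixed ⟩
    fold y g t               ≡⟨ x-split ⟨
    fold x g N               ∎
  where
    open ≡-Reasoning
    N = S !
    a = toℕ i
    d = toℕ j ∸ a
    y = fold x g a
    t = N ∸ a

    j≤S : toℕ j ≤ S
    j≤S = ≤-trans (≤-pred (toℕ<n j)) s≤S

    x-split : fold x g N ≡ fold y g t
    x-split = trans (cong (fold x g) (sym (m∸n+n≡m (≤-trans (<⇒≤ i<j) (≤-trans j≤S (n≤n! S))))))
                    (fold-+ x g t)

    y-periodic : fold y g d ≡ y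
    y-periodic = trans (sym (fold-+ x g d)) (trans (cong (fold x g) (m∸n+n≡m (<⇒≤ i<j))) (sym gⁱx≡gʲx))

    d∣N : d ∣ N
    d∣N = ∣-trans (n∣n! (m<n⇒0<n∸m i<j)) (m≤n⇒m!∣n! (≤-trans (m∸n≤m (toℕ j) a) j≤S))

    y-fixed : fold y g N ≡ y
    y-fixed = trans (cong (fold y g) (_∣_.equality d∣N)) (fold-multiple g y-periodic (_∣_.quotient d∣N))

upperBound : ∀ {n} (g : Fin n → ℕ) → ∃ λ S → ∀ ℓ → g ℓ ≤ S
upperBound {zero} g = 0 , λ ()
upperBound {suc n} g =
  let S , g∘suc≤S = upperBound (g ∘ suc)
  in g zero ⊔ S , λ { zero → m≤m⊔n (g zero) S ; (suc ℓ) → ≤-trans (g∘suc≤S ℓ) (m≤n⊔m (g zero) S) }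

substitute : ∀ {a b} → Term a → (Fin a → Term b) → Term b
substitute (var x) σ = σ x
substitute (s ·ₜ t) σ = substitute s σ ·ₜ substitute t σ
substitute (mₜ s t u) σ = mₜ (substitute s σ) (substitute t σ) (substitute u σ)

-- A unary polynomial term has its variable at position zero and its constants after it; when
-- polynomials are combined, their constant vectors are concatenated, c₁ ++ c₂.
substituteHead : ∀ {a₁} a₂ → Term (suc a₁) → Term (suc (a₁ + a₂)) → Term (suc (a₁ + a₂))
substituteHead a₂ t s = substitute t (s ∷ λ k → var (suc (k ↑ˡ a₂)))

weakenˡ : ∀ {a₁} a₂ → Term (suc a₁) → Term (suc (a₁ + a₂))
weakenˡ a₂ t = substituteHead a₂ t (var zero)

weakenʳ : ∀ a₁ {a₂} → Term (suc a₂) → Term (suc (a₁ + a₂))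
weakenʳ a₁ t = substitute t (var zero ∷ λ k → var (suc (a₁ ↑ʳ k)))

compose : ∀ {a₁ a₂} → Term (suc a₁) → Term (suc a₂) → Term (suc (a₁ + a₂))
compose {a₁} {a₂} t₁ t₂ = substituteHead a₂ t₁ (weakenʳ a₁ t₂)

-- Unary polynomial functions of a finite algebra

module Polynomials (A : Alg) where
  open Alg A
  open UPoly

  m-cong : ∀ {a a′ b b′ c c′} → a ≡ a′ → b ≡ b′ → c ≡ c′ → m a b c ≡ m a′ b′ c′
  m-cong refl refl refl = refl

  eval-cong : ∀ {a} (t : Term a) {ρ ρ′ : Fin a → Carrier} → ρ ≗ ρ′ → eval t ρ ≡ eval t ρ′
  eval-cong (var x) ρ≗ρ′ = ρ≗ρ′ x
  eval-cong (s ·ₜ t) ρ≗ρ′ = cong₂ _·_ (eval-cong s ρ≗ρ′) (eval-cong t ρ≗ρ′)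
  eval-cong (mₜ s t u) ρ≗ρ′ = m-cong (eval-cong s ρ≗ρ′) (eval-cong t ρ≗ρ′) (eval-cong u ρ≗ρ′)

  eval-substitute : ∀ {a b} (t : Term a) (σ : Fin a → Term b) (ρ : Fin b → Carrier) →
                    eval (substitute t σ) ρ ≡ eval t (λ v → eval (σ v) ρ)
  eval-substitute (var x) σ ρ = refl
  eval-substitute (s ·ₜ t) σ ρ = cong₂ _·_ (eval-substitute s σ ρ) (eval-substitute t σ ρ)
  eval-substitute (mₜ s t u) σ ρ =
    m-cong (eval-substitute s σ ρ) (eval-substitute t σ ρ) (eval-substitute u σ ρ)

  eval-substituteHead : ∀ {a₁ a₂} (t : Term (suc a₁)) s x (c₁ : Fin a₁ → Carrier) (c₂ : Fin a₂ → Carrier) →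
                        eval (substituteHead a₂ t s) (x ∷ c₁ ++ c₂) ≡ eval t (eval s (x ∷ c₁ ++ c₂) ∷ c₁)
  eval-substituteHead t s x c₁ c₂ =
    trans (eval-substitute t _ _) (eval-cong t λ { zero → refl ; (suc k) → lookup-++ˡ c₁ c₂ k })

  eval-weakenˡ : ∀ {a₁ a₂} (t : Term (suc a₁)) x (c₁ : Fin a₁ → Carrier) (c₂ : Fin a₂ → Carrier) →
                 eval (weakenˡ a₂ t) (x ∷ c₁ ++ c₂) ≡ eval t (x ∷ c₁)
  eval-weakenˡ t = eval-substituteHead t (var zero)

  eval-weakenʳ : ∀ {a₁ a₂} (t : Term (suc a₂)) x (c₁ : Fin a₁ → Carrier) (c₂ : Fin a₂ → Carrier) →
                 eval (weakenʳ a₁ t) (x ∷ c₁ ++ c₂) ≡ eval t (x ∷ c₂)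
  eval-weakenʳ t x c₁ c₂ =
    trans (eval-substitute t _ _) (eval-cong t λ { zero → refl ; (suc k) → lookup-++ʳ c₁ c₂ k })

  eval-compose : ∀ {a₁ a₂} (t₁ : Term (suc a₁)) (t₂ : Term (suc a₂)) x
                 (c₁ : Fin a₁ → Carrier) (c₂ : Fin a₂ → Carrier) →
                 eval (compose t₁ t₂) (x ∷ c₁ ++ c₂) ≡ eval t₁ (eval t₂ (x ∷ c₂) ∷ c₁)
  eval-compose t₁ t₂ x c₁ c₂ =
    trans (eval-substituteHead t₁ _ x c₁ c₂) (cong (λ y → eval t₁ (y ∷ c₁)) (eval-weakenʳ t₂ x c₁ c₂))

  eval-preserves : ∀ {θ} → IsCongruence θ → ∀ {a} (t : Term a) {ρ ρ′ : Fin a → Carrier} →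
                   (∀ v → θ (ρ v) (ρ′ v)) → θ (eval t ρ) (eval t ρ′)
  eval-preserves C (var x) θρρ′ = θρρ′ x
  eval-preserves C (s ·ₜ t) θρρ′ =
    IsCongruence.compat· C _ _ _ _ (eval-preserves C s θρρ′) (eval-preserves C t θρρ′)
  eval-preserves C (mₜ s t u) θρρ′ =
    IsCongruence.compatm C _ _ _ _ _ _
      (eval-preserves C s θρρ′) (eval-preserves C t θρρ′) (eval-preserves C u θρρ′)

  apply-preserves : ∀ {θ} → IsCongruence θ → (p : UPoly) → MapsInto (apply p) θ θ
  apply-preserves C p x y θxy = eval-preserves C (term p) λ { zero → θxy ; (suc k) → IsCongruence.refl C _ }

  polynomial : ∀ {a} → Term (suc a) → (Fin a → Carrier) → UPoly
  polynomial t c = record { arity = _ ; term = t ; consts = c }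

  IsPolynomial : (Carrier → Carrier) → Set
  IsPolynomial F = Σ UPoly λ p → apply p ≗ F

  isPolynomial-resp : ∀ {F G} → F ≗ G → IsPolynomial F → IsPolynomial G
  isPolynomial-resp F≗G (p , p≗F) = p , λ x → trans (p≗F x) (F≗G x)

  isPolynomial-preserves : ∀ {θ F} → IsCongruence θ → IsPolynomial F → MapsInto F θ θ
  isPolynomial-preserves {θ} C (p , p≗F) = MapsInto-resp {β = θ} {θ} p≗F (apply-preserves C p)

  id-isPolynomial : IsPolynomial id
  id-isPolynomial = polynomial {0} (var zero) (λ ()) , λ _ → refl

  const-isPolynomial : ∀ c → IsPolynomial (const c)
  const-isPolynomial c = polynomial {1} (var (suc zero)) (λ _ → c) , λ _ → refl

  ∘-isPolynomial : ∀ {F G} → IsPolynomial F → IsPolynomial G → IsPolynomial (F ∘ G)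
  ∘-isPolynomial {F} (p , p≗F) (q , q≗G) =
    polynomial (compose (term p) (term q)) (consts p ++ consts q) ,
    λ x → trans (eval-compose (term p) (term q) x (consts p) (consts q)) (trans (p≗F _) (cong F (q≗G x)))

  ·-isPolynomial : ∀ {F G} → IsPolynomial F → IsPolynomial G → IsPolynomial (λ x → F x · G x)
  ·-isPolynomial (p , p≗F) (q , q≗G) =
    polynomial (weakenˡ (arity q) (term p) ·ₜ weakenʳ (arity p) (term q)) (consts p ++ consts q) ,
    λ x → cong₂ _·_ (trans (eval-weakenˡ (term p) x (consts p) (consts q)) (p≗F x))
                    (trans (eval-weakenʳ (term q) x (consts p) (consts q)) (q≗G x))

  m-isPolynomial : ∀ {F G H} → IsPolynomial F → IsPolynomial G → IsPolynomial H →
                   IsPolynomial (λ x → m (F x) (G x) (H x))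
  m-isPolynomial (p , p≗F) (q , q≗G) (r , r≗H) =
    polynomial (mₜ (weakenˡ (arity r) (weakenˡ (arity q) (term p)))
                   (weakenˡ (arity r) (weakenʳ (arity p) (term q)))
                   (weakenʳ (arity p + arity q) (term r)))
               ((consts p ++ consts q) ++ consts r) ,
    λ x → m-cong
      (trans (eval-weakenˡ (weakenˡ (arity q) (term p)) x (consts p ++ consts q) (consts r))
             (trans (eval-weakenˡ (term p) x (consts p) (consts q)) (p≗F x)))
      (trans (eval-weakenˡ (weakenʳ (arity p) (term q)) x (consts p ++ consts q) (consts r))
             (trans (eval-weakenʳ (term q) x (consts p) (consts q)) (q≗G x)))
      (trans (eval-weakenʳ (term r) x (consts p ++ consts q) (consts r)) (r≗H x))

-- Finite search through the polynomial functions

module _ {K : ℕ} {P : Fin K → Set} (P? : ∀ φ → Dec (P φ)) where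

  ∈-tabulate⁺ : ∀ {φ} → P φ → φ ∈ tabulate (λ ψ → does (P? ψ))
  ∈-tabulate⁺ {φ} Pφ = lookup⇒[]= φ _ (trans (lookup∘tabulate (λ ψ → does (P? ψ)) φ) (dec-true (P? φ) Pφ))

  ∈-tabulate⁻ : ∀ {φ} → φ ∈ tabulate (λ ψ → does (P? ψ)) → P φ
  ∈-tabulate⁻ {φ} φ∈ =
    does-true (P? φ) (trans (sym (lookup∘tabulate (λ ψ → does (P? ψ)) φ)) ([]=⇒lookup φ∈))
    where
      does-true : ∀ {B : Set} (B? : Dec B) → does B? ≡ true → B
      does-true (yes b) _ = b
      does-true (no _) ()

module _ {K : ℕ} (F : Subset K → Subset K) (inflationary : ∀ S → S ⊆ F S) where

  private
    chain : ℕ → Subset K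
    chain k = fold ∅ F k

    closed⊎growing : ∀ k → (∃ λ j → F (chain j) ⊆ chain j) ⊎ k ≤ ∣ chain k ∣
    closed⊎growing zero = inj₂ z≤n
    closed⊎growing (suc k) with closed⊎growing k
    ... | inj₁ closed = inj₁ closed
    ... | inj₂ k≤∣chain∣ with chain k ⊂? F (chain k)
    ...   | yes chain⊂ = inj₂ (≤-trans (s≤s k≤∣chain∣) (p⊂q⇒∣p∣<∣q∣ chain⊂))
    ...   | no ¬chain⊂ = inj₁ (k , closed)
      where
        closed : F (chain k) ⊆ chain k
        closed {φ} φ∈F with φ ∈? chain k
        ... | yes φ∈ = φ∈
        ... | no φ∉ = contradiction ((λ {ψ} → inflationary (chain k) {ψ}) , φ , φ∈F , φ∉) ¬chain⊂

  postfixpoint : ∃ λ k → F (fold ∅ F k) ⊆ fold ∅ F k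
  postfixpoint with closed⊎growing (suc K)
  ... | inj₁ closed = closed
  ... | inj₂ K<∣chain∣ = contradiction (≤-trans K<∣chain∣ (∣p∣≤n (chain (suc K)))) (n≮n K)

module Enumeration (A : Alg) where
  open Alg A
  open Polynomials A

  private
    K : ℕ
    K = size ^ size

    decode : Fin K → Carrier → Carrier
    decode = finToFun

    encode : (Carrier → Carrier) → Fin K
    encode = funToFin

    _≗?_ : ∀ (F G : Carrier → Carrier) → Dec (F ≗ G)
    F ≗? G = all? λ x → F x ≟ G x

  -- φ codes a function obtained from the functions coded in S by one step of generating the
  -- clone of unary polynomial functions.
  Generated : Subset K → Fin K → Set
  Generated S φ =
    φ ∈ S ⊎ decode φ ≗ id ⊎ (∃ λ c → decode φ ≗ const c) ⊎
    (∃₂ λ a b → a ∈ S × b ∈ S × decode φ ≗ λ x → decode a x · decode b x) ⊎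
    (∃₂ λ a b → ∃ λ c → a ∈ S × b ∈ S × c ∈ S ×
                         decode φ ≗ λ x → m (decode a x) (decode b x) (decode c x))

  generated? : ∀ S φ → Dec (Generated S φ)
  generated? S φ =
    φ ∈? S ⊎-dec decode φ ≗? id ⊎-dec any? (λ c → decode φ ≗? const c) ⊎-dec
    any? (λ a → any? λ b → a ∈? S ×-dec b ∈? S ×-dec decode φ ≗? λ x → decode a x · decode b x) ⊎-dec
    any? (λ a → any? λ b → any? λ c → a ∈? S ×-dec b ∈? S ×-dec c ∈? S ×-dec
                                      decode φ ≗? λ x → m (decode a x) (decode b x) (decode c x))

  generate : Subset K → Subset K
  generate S = tabulate (λ φ → does (generated? S φ))

  private
    generate-postfixpoint : ∃ λ k → generate (fold ∅ generate k) ⊆ fold ∅ generate k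
    generate-postfixpoint = postfixpoint generate λ S → ∈-tabulate⁺ (generated? S) ∘ inj₁

    stage : ℕ
    stage = proj₁ generate-postfixpoint

  closure : Subset K
  closure = fold ∅ generate stage

  generate-closure : ∀ {φ} → Generated closure φ → φ ∈ closure
  generate-closure = proj₂ generate-postfixpoint ∘ ∈-tabulate⁺ (generated? closure)

  generate-sound : ∀ k {φ} → φ ∈ fold ∅ generate k → IsPolynomial (decode φ)
  generate-sound zero φ∈ = contradiction φ∈ ∉⊥
  generate-sound (suc k) φ∈ with ∈-tabulate⁻ (generated? _) φ∈
  ... | inj₁ φ∈S = generate-sound k φ∈S
  ... | inj₂ (inj₁ φ≗id) = isPolynomial-resp (sym ∘ φ≗id) id-isPolynomial
  ... | inj₂ (inj₂ (inj₁ (c , φ≗c))) = isPolynomial-resp (sym ∘ φ≗c) (const-isPolynomial c)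
  ... | inj₂ (inj₂ (inj₂ (inj₁ (a , b , a∈ , b∈ , φ≗)))) =
    isPolynomial-resp (sym ∘ φ≗) (·-isPolynomial (generate-sound k a∈) (generate-sound k b∈))
  ... | inj₂ (inj₂ (inj₂ (inj₂ (a , b , c , a∈ , b∈ , c∈ , φ≗)))) =
    isPolynomial-resp (sym ∘ φ≗)
      (m-isPolynomial (generate-sound k a∈) (generate-sound k b∈) (generate-sound k c∈))

  closure-complete : ∀ {a} (t : Term (suc a)) (c : Fin a → Carrier) →
                     ∃ λ φ → φ ∈ closure × decode φ ≗ λ x → eval t (x ∷ c)
  closure-complete (var zero) c =
    encode id , generate-closure (inj₂ (inj₁ (finToFun-funToFin id))) , finToFun-funToFin id
  closure-complete (var (suc k)) c =
    encode (const (c k)) , generate-closure (inj₂ (inj₂ (inj₁ (c k , finToFun-funToFin _)))) , finToFun-funToFin _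
  closure-complete (s ·ₜ t) c =
    let a , a∈ , a≗s = closure-complete s c
        b , b∈ , b≗t = closure-complete t c
    in encode (λ x → decode a x · decode b x) ,
       generate-closure (inj₂ (inj₂ (inj₂ (inj₁ (a , b , a∈ , b∈ , finToFun-funToFin _))))) ,
       λ x → trans (finToFun-funToFin _ x) (cong₂ _·_ (a≗s x) (b≗t x))
  closure-complete (mₜ s t u) c =
    let a , a∈ , a≗s = closure-complete s c
        b , b∈ , b≗t = closure-complete t c
        d , d∈ , d≗u = closure-complete u c
    in encode (λ x → m (decode a x) (decode b x) (decode d x)) ,
       generate-closure (inj₂ (inj₂ (inj₂ (inj₂ (a , b , d , a∈ , b∈ , d∈ , finToFun-funToFin _))))) ,
       λ x → trans (finToFun-funToFin _ x) (m-cong (a≗s x) (b≗t x) (d≗u x))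

  search : (P : (Carrier → Carrier) → Set) → (∀ {F G} → F ≗ G → P F → P G) →
           (∀ {F} → IsPolynomial F → Dec (P F)) → ¬ (∀ {F} → IsPolynomial F → ¬ P F) →
           ∃ λ F → IsPolynomial F × P F
  search P P-resp P? ¬none with any? found?
    where
      found? : ∀ φ → Dec (φ ∈ closure × P (decode φ))
      found? φ with φ ∈? closure
      ... | yes φ∈ = map′ (φ∈ ,_) proj₂ (P? (generate-sound stage φ∈))
      ... | no φ∉ = no (φ∉ ∘ proj₁)
  ... | yes (φ , φ∈ , Pφ) = decode φ , generate-sound stage φ∈ , Pφ
  ... | no ¬found = contradiction (λ {F} → none {F}) ¬none
    where
      none : ∀ {F} → IsPolynomial F → ¬ P F
      none {F} (p , p≗F) PF =
        let φ , φ∈ , φ≗p = closure-complete (UPoly.term p) (UPoly.consts p)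
        in ¬found (φ , φ∈ , P-resp (λ x → trans (sym (p≗F x)) (sym (φ≗p x))) PF)

-- Polynomials collapsing a covering pair of congruences

module Covering (A : Alg) {α β : Rel (Alg.Carrier A)}
  (α-cong : Alg.IsCongruence A α) (β-cong : Alg.IsCongruence A β) (α≺β : Alg.Covers A α β) where
  open Alg A
  open Polynomials A
  open Enumeration A using (search)

  private
    module α = IsCongruence α-cong
    module β = IsCongruence β-cong

  collapseKernel : (Carrier → Carrier) → Rel Carrier
  collapseKernel F x y = β x y × (∀ {Q} → IsPolynomial Q → α (F (Q x)) (F (Q y)))

  collapseKernel-isCongruence : ∀ F → IsCongruence (collapseKernel F)
  collapseKernel-isCongruence F = record
    { refl = λ a → β.refl a , λ _ → α.refl _
    ; sym = λ a b κab → β.sym a b (proj₁ κab) , λ Q-poly → α.sym _ _ (proj₂ κab Q-poly)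
    ; trans = λ a b c κab κbc →
        β.trans a b c (proj₁ κab) (proj₁ κbc) ,
        λ Q-poly → α.trans _ _ _ (proj₂ κab Q-poly) (proj₂ κbc Q-poly)
    ; compat· = λ a a′ b b′ κa κb → β.compat· a a′ b b′ (proj₁ κa) (proj₁ κb) , λ Q-poly →
        α.trans _ _ _
          (translate κa Q-poly (·-isPolynomial id-isPolynomial (const-isPolynomial b)))
          (translate κb Q-poly (·-isPolynomial (const-isPolynomial a′) id-isPolynomial))
    ; compatm = λ a a′ b b′ c c′ κa κb κc →
        β.compatm a a′ b b′ c c′ (proj₁ κa) (proj₁ κb) (proj₁ κc) , λ Q-poly →
        α.trans _ _ _
          (translate κa Q-poly (m-isPolynomial id-isPolynomial (const-isPolynomial b) (const-isPolynomial c)))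
          (α.trans _ _ _
            (translate κb Q-poly (m-isPolynomial (const-isPolynomial a′) id-isPolynomial (const-isPolynomial c)))
            (translate κc Q-poly (m-isPolynomial (const-isPolynomial a′) (const-isPolynomial b′) id-isPolynomial)))
    }
    where
      translate : ∀ {x y} → collapseKernel F x y → ∀ {Q T} → IsPolynomial Q → IsPolynomial T →
                  α (F (Q (T x))) (F (Q (T y)))
      translate κxy Q-poly T-poly = proj₂ κxy (∘-isPolynomial Q-poly T-poly)

  -- α ⊆ collapseKernel F ⊆ β, so α ≺ β leaves only the two extreme cases.
  collapseKernel-extreme : ∀ {F} → MapsInto F α α → (collapseKernel F ⊆ᵣ α) ⊎ (β ⊆ᵣ collapseKernel F)
  collapseKernel-extreme {F} F-pres = proj₂ (proj₂ α≺β) (collapseKernel F) (collapseKernel-isCongruence F)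
    (λ a b αab → proj₁ α≺β a b αab , λ Q-poly → F-pres _ _ (isPolynomial-preserves α-cong Q-poly a b αab))
    (λ _ _ → proj₁)

  collapses? : ∀ {F} → MapsInto F α α → Dec (MapsInto F β α)
  collapses? F-pres with collapseKernel-extreme F-pres
  ... | inj₂ β⊆κ = yes λ a b βab → proj₂ (β⊆κ a b βab) id-isPolynomial
  ... | inj₁ κ⊆α = no λ F-collapses → proj₁ (proj₂ α≺β) λ a b βab →
          κ⊆α a b (βab , λ Q-poly → F-collapses _ _ (isPolynomial-preserves β-cong Q-poly a b βab))

  collapse-factors : ∀ {X Y} → MapsInto X α α → MapsInto Y β β →
                     (∀ {Q} → IsPolynomial Q → MapsInto (X ∘ Q ∘ Y) β α) → MapsInto X β α ⊎ MapsInto Y β α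
  collapse-factors X-pres Y-pres all-collapse with collapseKernel-extreme X-pres
  ... | inj₂ β⊆κ = inj₁ λ a b βab → proj₂ (β⊆κ a b βab) id-isPolynomial
  ... | inj₁ κ⊆α = inj₂ λ a b βab → κ⊆α _ _ (Y-pres a b βab , λ Q-poly → all-collapse Q-poly a b βab)

  nonCollapsing-composite : ∀ {X Y} → IsPolynomial X → IsPolynomial Y →
                            ¬ MapsInto X β α → ¬ MapsInto Y β α →
                            ∃ λ Q → IsPolynomial Q × ¬ MapsInto (X ∘ Q ∘ Y) β α
  nonCollapsing-composite {X} {Y} X-poly Y-poly X-sep Y-sep =
    search (λ Q → ¬ MapsInto (X ∘ Q ∘ Y) β α) separation-resp decide none
    where
      preserves-α : ∀ {Q} → IsPolynomial Q → MapsInto (X ∘ Q ∘ Y) α α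
      preserves-α Q-poly = isPolynomial-preserves α-cong (∘-isPolynomial X-poly (∘-isPolynomial Q-poly Y-poly))

      separation-resp : ∀ {F G} → F ≗ G → ¬ MapsInto (X ∘ F ∘ Y) β α → ¬ MapsInto (X ∘ G ∘ Y) β α
      separation-resp F≗G F-sep = F-sep ∘ MapsInto-resp {β = β} {α} (λ x → cong X (sym (F≗G (Y x))))

      decide : ∀ {Q} → IsPolynomial Q → Dec (¬ MapsInto (X ∘ Q ∘ Y) β α)
      decide Q-poly = ¬? (collapses? (preserves-α Q-poly))

      none : ¬ (∀ {Q} → IsPolynomial Q → ¬ ¬ MapsInto (X ∘ Q ∘ Y) β α)
      none all = [ X-sep , Y-sep ]
        (collapse-factors (isPolynomial-preserves α-cong X-poly) (isPolynomial-preserves β-cong Y-poly)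
          λ Q-poly → decidable-stable (collapses? (preserves-α Q-poly)) (all Q-poly))

module ProductPolynomials {n : ℕ} (As : Fin n → SBM) {R : Pred (Product.Tuple As)}
  (R-subdirect : Product.IsSubdirect As R) where
  open Product As
  open UPolyR

  private
    alg : Fin n → Alg
    alg ℓ = SBM.alg (As ℓ)

    module Poly (ℓ : Fin n) = Polynomials (alg ℓ)

  coordPoly : UPolyR R → (ℓ : Fin n) → Alg.UPoly (alg ℓ)
  coordPoly f ℓ = record { arity = arity f ; term = term f ; consts = λ k → consts f k ℓ }

  coord-isPolynomial : ∀ (f : UPolyR R) ℓ → Poly.IsPolynomial ℓ (coord f ℓ)
  coord-isPolynomial f ℓ = coordPoly f ℓ , λ _ → refl

  coord-preserves : ∀ (f : UPolyR R) ℓ {θ} → Alg.IsCongruence (alg ℓ) θ → MapsInto (coord f ℓ) θ θ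
  coord-preserves f ℓ θ-cong = Poly.isPolynomial-preserves ℓ θ-cong (coord-isPolynomial f ℓ)

  lift : ∀ ℓ {F} → Poly.IsPolynomial ℓ F → ∃ λ (f : UPolyR R) → coord f ℓ ≗ F
  lift ℓ (p , p≗F) =
    record { arity = Alg.UPoly.arity p ; term = Alg.UPoly.term p
           ; consts = λ k → proj₁ (preimage k) ; constsInR = λ k → proj₁ (proj₂ (preimage k)) } ,
    λ x → trans (Poly.eval-cong ℓ (Alg.UPoly.term p) λ { zero → refl ; (suc k) → proj₂ (proj₂ (preimage k)) })
                (p≗F x)
    where
      preimage = λ k → IsSubdirect.surj R-subdirect ℓ (Alg.UPoly.consts p k)

  idR : UPolyR R
  idR = record { arity = 0 ; term = var zero ; consts = λ () ; constsInR = λ () }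

  _∘R_ : UPolyR R → UPolyR R → UPolyR R
  f ∘R g = record { arity = arity f + arity g ; term = compose (term f) (term g)
                  ; consts = consts f ++ consts g ; constsInR = ++⁺ R (constsInR f) (constsInR g) }

  coord-∘R : ∀ f g ℓ → coord (f ∘R g) ℓ ≗ coord f ℓ ∘ coord g ℓ
  coord-∘R f g ℓ x =
    trans (Poly.eval-cong ℓ (compose (term f) (term g))
             λ { zero → refl
               ; (suc k) → [,]-∘ (λ (r : Tuple) → r ℓ) {consts f} {consts g} (splitAt (arity f) k) })
          (Poly.eval-compose ℓ (term f) (term g) x _ _)

  _^R_ : UPolyR R → ℕ → UPolyR R
  f ^R zero = idR
  f ^R suc k = f ∘R (f ^R k)

  coord-^R : ∀ f k ℓ x → coord (f ^R k) ℓ x ≡ fold x (coord f ℓ) k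
  coord-^R f zero ℓ x = refl
  coord-^R f (suc k) ℓ x = trans (coord-∘R f (f ^R k) ℓ x) (cong (coord f ℓ) (coord-^R f k ℓ x))

  private
    sizeBound : ℕ
    sizeBound = proj₁ (upperBound (λ ℓ → Alg.size (alg ℓ)))

    size≤sizeBound : ∀ ℓ → Alg.size (alg ℓ) ≤ sizeBound
    size≤sizeBound = proj₂ (upperBound (λ ℓ → Alg.size (alg ℓ)))

  idempotentExponent : ℕ
  idempotentExponent = sizeBound !

  1≤idempotentExponent : 1 ≤ idempotentExponent
  1≤idempotentExponent = 1≤n! sizeBound

  ^R-idempotent : ∀ f ℓ x → coord (f ^R idempotentExponent) ℓ (coord (f ^R idempotentExponent) ℓ x)
                            ≡ coord (f ^R idempotentExponent) ℓ x
  ^R-idempotent f ℓ x = begin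
    coord fᴺ ℓ (coord fᴺ ℓ x)  ≡⟨ coord-^R f N ℓ _ ⟩
    fold (coord fᴺ ℓ x) fℓ N   ≡⟨ cong (λ y → fold y fℓ N) (coord-^R f N ℓ x) ⟩
    fold (fold x fℓ N) fℓ N    ≡⟨ fold-idempotent fℓ (size≤sizeBound ℓ) x ⟩
    fold x fℓ N                ≡⟨ coord-^R f N ℓ x ⟨
    coord fᴺ ℓ x               ∎
    where
      open ≡-Reasoning
      N = idempotentExponent
      fᴺ = f ^R N
      fℓ = coord f ℓ

-- Separating polynomials whose i-th coordinate retracts onto a minimal set

module Separation {n : ℕ} (As : Fin n → SBM) {R : Pred (Product.Tuple As)}
  (R-subdirect : Product.IsSubdirect As R) (i j : Fin n)
  {α β : Rel (Car (As i))} {γ δ : Rel (Car (As j))}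
  (α-cong : Alg.IsCongruence (SBM.alg (As i)) α) (β-cong : Alg.IsCongruence (SBM.alg (As i)) β)
  (α≺β : Alg.Covers (SBM.alg (As i)) α β)
  (γ-cong : Alg.IsCongruence (SBM.alg (As j)) γ) (δ-cong : Alg.IsCongruence (SBM.alg (As j)) δ)
  {U : Pred (Car (As i))} (U-minimal : Alg.IsMinimalSet (SBM.alg (As i)) α β U) where

  open Product As
  open UPolyR using (coord)
  open ProductPolynomials As R-subdirect
  open Polynomials (SBM.alg (As i))
  open Covering (SBM.alg (As i)) α-cong β-cong α≺β

  Separating : UPolyR R → Set
  Separating f = Separates f i j α β γ δ

  CollapsesOnU : (Car (As i) → Car (As i)) → Set
  CollapsesOnU F = ∀ c d → U c → U d → β c d → α (F c) (F d)

  record SeparatingOnU (p : UPolyR R) : Set where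
    field
      image⊆U : Image (coord p i) ⊆ₚ U
      surjectiveOnU : SurjectiveOn U (coord p i)
      separatesOnU : ¬ CollapsesOnU (coord p i)
      collapsesδ : MapsInto (coord p j) δ γ

  private
    respᵢ : ∀ {F G} → F ≗ G → MapsInto F β α → MapsInto G β α
    respᵢ = MapsInto-resp {β = β} {α}

    respⱼ : ∀ {F G} → F ≗ G → MapsInto F δ γ → MapsInto G δ γ
    respⱼ = MapsInto-resp {β = δ} {γ}

  separating-into : ∀ f → Separating f → ∀ {H} → IsPolynomial H → ¬ MapsInto H β α →
                    ∃ λ e → Separating e × Image (coord e i) ⊆ₚ Image H
  separating-into f (fᵢ-sep , fⱼ-into) {H} H-poly H-sep = e , (eᵢ-sep , eⱼ-into) , eᵢ⊆H
    where
      found = nonCollapsing-composite H-poly (coord-isPolynomial f i) H-sep fᵢ-sep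
      q = proj₁ found
      lifted = lift i (∘-isPolynomial H-poly (proj₁ (proj₂ found)))
      g = proj₁ lifted
      e = g ∘R f

      eᵢ≗Hqfᵢ : coord e i ≗ H ∘ q ∘ coord f i
      eᵢ≗Hqfᵢ x = trans (coord-∘R g f i x) (proj₂ lifted _)

      eᵢ-sep : ¬ MapsInto (coord e i) β α
      eᵢ-sep eᵢ-collapses = proj₂ (proj₂ found) (respᵢ eᵢ≗Hqfᵢ eᵢ-collapses)

      eⱼ-into : MapsInto (coord e j) δ γ
      eⱼ-into = respⱼ (λ x → sym (coord-∘R g f j x))
                  (MapsInto-∘ {α = δ} {γ} {γ} (coord-preserves g j γ-cong) fⱼ-into)

      eᵢ⊆H : Image (coord e i) ⊆ₚ Image H
      eᵢ⊆H y (x , eᵢx≡y) = q (coord f i x) , trans (sym (eᵢ≗Hqfᵢ x)) eᵢx≡y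

  separating-onto : ∀ e → Separating e → Image (coord e i) ⊆ₚ U → ∃ SeparatingOnU
  separating-onto e (eᵢ-sep , eⱼ-into) eᵢ⊆U = p , record
    { image⊆U = λ y (x , pᵢx≡y) → subst U (trans (sym (pᵢ≗eᵢq x)) pᵢx≡y) (eᵢ∈U (q x))
    ; surjectiveOnU = λ u Uu →
        let x , pₑx≡u = proj₂ U-minimal (coordPoly (p ∘R e) i) pₑ-sep pₑ⊆U u Uu
        in coord e i x , eᵢ∈U x , trans (sym (coord-∘R p e i x)) pₑx≡u
    ; separatesOnU = λ pᵢ-collapses → pₑ-sep (respᵢ (λ x → sym (coord-∘R p e i x)) λ a b βab →
        pᵢ-collapses _ _ (eᵢ∈U a) (eᵢ∈U b) (coord-preserves e i β-cong a b βab))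
    ; collapsesδ = respⱼ (λ x → sym (coord-∘R e g j x))
        (MapsInto-∘ {α = δ} {δ} {γ} eⱼ-into (coord-preserves g j δ-cong))
    }
    where
      found = nonCollapsing-composite (coord-isPolynomial e i) (coord-isPolynomial e i) eᵢ-sep eᵢ-sep
      q = proj₁ found
      lifted = lift i (proj₁ (proj₂ found))
      g = proj₁ lifted
      p = e ∘R g

      eᵢ∈U : ∀ x → U (coord e i x)
      eᵢ∈U x = eᵢ⊆U _ (x , refl)

      pᵢ≗eᵢq : coord p i ≗ coord e i ∘ q
      pᵢ≗eᵢq x = trans (coord-∘R e g i x) (cong (coord e i) (proj₂ lifted x))

      pₑ≗eᵢqeᵢ : coord (p ∘R e) i ≗ coord e i ∘ q ∘ coord e i
      pₑ≗eᵢqeᵢ x = trans (coord-∘R p e i x) (pᵢ≗eᵢq _)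

      pₑ-sep : ¬ MapsInto (coord (p ∘R e) i) β α
      pₑ-sep pₑ-collapses = proj₂ (proj₂ found) (respᵢ pₑ≗eᵢqeᵢ pₑ-collapses)

      pₑ⊆U : Image (coord (p ∘R e) i) ⊆ₚ U
      pₑ⊆U y (x , pₑx≡y) = subst U (trans (sym (pₑ≗eᵢqeᵢ x)) pₑx≡y) (eᵢ∈U _)

  idempotent-separating : ∀ p → SeparatingOnU p →
                          Σ (UPolyR R) λ g → IdempotentR g × (Image (coord g i) ≐ U) × Separating g
  idempotent-separating p p-onU =
    g , (λ r _ ℓ → ^R-idempotent p ℓ (r ℓ)) , (g⊆U , U⊆g) , gᵢ-sep , gⱼ-into
    where
      open SeparatingOnU p-onU
      N = idempotentExponent
      g = p ^R N

      g⊆U : Image (coord g i) ⊆ₚ U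
      g⊆U y (x , gx≡y) =
        fold-image {g = coord p i} image⊆U 1≤idempotentExponent y (x , trans (sym (coord-^R p N i x)) gx≡y)

      U⊆g : U ⊆ₚ Image (coord g i)
      U⊆g u Uu = let w , _ , pᴺw≡u = fold-surjectiveOn surjectiveOnU N u Uu in w , trans (coord-^R p N i w) pᴺw≡u

      fixes-U : ∀ {c} → U c → coord g i c ≡ c
      fixes-U Uc = let x , gx≡c = U⊆g _ Uc in
        trans (cong (coord g i) (sym gx≡c)) (trans (^R-idempotent p i x) gx≡c)

      gᵢ-sep : ¬ MapsInto (coord g i) β α
      gᵢ-sep gᵢ-collapses = separatesOnU λ c d Uc Ud βcd →
        coord-preserves p i α-cong c d (subst₂ α (fixes-U Uc) (fixes-U Ud) (gᵢ-collapses c d βcd))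

      gⱼ-into : MapsInto (coord g j) δ γ
      gⱼ-into = respⱼ (λ x → sym (coord-^R p N j x))
                  (fold-mapsInto {δ = δ} {γ} (coord-preserves p j δ-cong) collapsesδ 1≤idempotentExponent)

lemma15 : ∀ {n : ℕ} (As : Fin n → SBM) (R : Pred (Product.Tuple As)) →
  Product.IsSubdirect As R →
  (i j : Fin n) →
  (α β : Rel (Car (As i))) (γ δ : Rel (Car (As j))) →
  Alg.IsCongruence (SBM.alg (As i)) α → Alg.IsCongruence (SBM.alg (As i)) β →
  Alg.Covers (SBM.alg (As i)) α β → β ⊆ᵣ SBM.θ (As i) →
  Alg.IsCongruence (SBM.alg (As j)) γ → Alg.IsCongruence (SBM.alg (As j)) δ →
  Alg.Covers (SBM.alg (As j)) γ δ → δ ⊆ᵣ SBM.θ (As j) →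
  Σ (Product.UPolyR As R) (λ f → Product.Separates As f i j α β γ δ) →
  (U : Pred (Car (As i))) → Alg.IsMinimalSet (SBM.alg (As i)) α β U →
  Σ (Product.UPolyR As R) (λ g →
    Product.IdempotentR As g ×
    (Image (Product.UPolyR.coord g i) ≐ U) ×
    Product.Separates As g i j α β γ δ)
lemma15 As R R-subdirect i j α β γ δ α-cong β-cong α≺β _ γ-cong δ-cong _ _ (f , f-sep) U U-minimal =
  let h , h-sep , _ , h⊆U = proj₁ U-minimal
      e , e-sep , eᵢ⊆h = separating-into f f-sep (h , λ _ → refl) h-sep
      p , p-onU = separating-onto e e-sep (λ y y∈eᵢ → h⊆U y (eᵢ⊆h y y∈eᵢ))
  in idempotent-separating p p-onU
  where open Separation As R-subdirect i j α-cong β-cong α≺β γ-cong δ-cong U-minimal
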